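{- Let $G$ be a finite connected simple graph with twin classes $C_1,\dots,C_k$, and let $S$ be a set of $l\ge 1$ vertices of $G$ such that $|S\cap C_i|\le 1$ for every $1\le i\le k$. Then the representatives $c_i\in C_i$ can be chosen so that $S\subseteq\{c_1,\dots,c_k\}$ (i.e. $S=S_r$), and for such a choice of representatives, with $H=G[\{c_1,\dots,c_k\}]$, one has $d_H^l(S)=d_G^l(S)$.
   Context: $N_G(v)$ is the open neighbourhood of $v$. The twin relation $u\sim^G v$ iff $N_G(u)\setminus\{v\}=N_G(v)\setminus\{u\}$ is an equivalence relation; its classes $C_1,\dots,C_k$ are the twin classes, and after choosing representatives $c_i\in C_i$, $H=G[\{c_1,\dots,c_k\}]$ is the reduced graph. For $S$ a set of vertices, $S_r=\{c_i: S\cap C_i\neq\emptyset\}$. For a connected graph $X$ and a set $S$ of $l$ vertices of $X$, the $l$-Steiner distance $d_X^l(S)$ is the number of edges of a smallest subtree of $X$ containing $S$. -}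

module Defs where

open import Data.Nat using (ℕ; _≤_)
open import Data.Fin using (Fin; toℕ)
open import Data.Fin.Subset using (Subset; _∈_; Nonempty)
open import Data.Bool using (Bool; true; false)
import Data.Bool.Properties as BoolP
open import Data.List using (List; []; _∷_; _++_; length; filter; cartesianProduct)
open import Data.List.Relation.Unary.Unique.Propositional using (Unique)
open import Data.List.Relation.Unary.Linked using (Linked)
open import Data.Product using (Σ; ∃; _×_; _,_; proj₁; proj₂)
open import Data.Product.Properties using ()
open import Relation.Nullary using (¬_)
open import Relation.Nullary.Decidable using (_×-dec_)
open import Relation.Binary.PropositionalEquality using (_≡_; _≢_)
open import Function.Bundles using (_⇔_)
open import Data.Vec using (tabulate; lookup)
import Data.Nat as ℕ

record Graph (n : ℕ) : Set where
  field
    adj        : Fin n → Fin n → Bool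
    adj-sym    : ∀ u v → adj u v ≡ adj v u
    adj-irrefl : ∀ v → adj v v ≡ false
open Graph public

data Walk {n : ℕ} (E : Fin n → Fin n → Bool) : Fin n → Fin n → Set where
  []  : ∀ {u} → Walk E u u
  _∷_ : ∀ {u w v} → E u w ≡ true → Walk E w v → Walk E u v

Connected : ∀ {n} → Graph n → Set
Connected G = ∀ u v → Walk (adj G) u v

N : ∀ {n} → Graph n → Fin n → Fin n → Set
N G v w = adj G v w ≡ true

Twin : ∀ {n} → Graph n → Fin n → Fin n → Set
Twin G u v = ∀ w → (N G u w × w ≢ v) ⇔ (N G v w × w ≢ u)

-- c : Fin k → Fin n is a choice of representatives c_1..c_k of the twin classes
-- C_1..C_k (C_i = class of c_i): distinct c_i lie in distinct classes and every
-- vertex lies in some class.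
record Representatives {n : ℕ} (G : Graph n) (k : ℕ) (c : Fin k → Fin n) : Set where
  field
    distinct : ∀ i j → Twin G (c i) (c j) → i ≡ j
    cover    : ∀ v → ∃ λ i → Twin G v (c i)

-- The reduced graph H = G[{c_1,…,c_k}], with vertex c_i relabelled i.
induced : ∀ {n k} → Graph n → (Fin k → Fin n) → Graph k
induced G c = record
  { adj        = λ i j → adj G (c i) (c j)
  ; adj-sym    = λ i j → adj-sym G (c i) (c j)
  ; adj-irrefl = λ i → adj-irrefl G (c i)
  }

pullback : ∀ {n k} → (Fin k → Fin n) → Subset n → Subset k
pullback c S = tabulate (λ i → lookup S (c i))

IsCycle : ∀ {n} → (Fin n → Fin n → Bool) → Fin n → List (Fin n) → Set
IsCycle E v rest =
  2 ≤ length rest × Unique (v ∷ rest) × Linked (λ a b → E a b ≡ true) (v ∷ rest ++ v ∷ [])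

record Subtree {n : ℕ} (X : Graph n) : Set where
  field
    verts       : Subset n
    edges       : Fin n → Fin n → Bool
    edges-sym   : ∀ u v → edges u v ≡ edges v u
    edges-⊆     : ∀ u v → edges u v ≡ true → adj X u v ≡ true
    edges-verts : ∀ u v → edges u v ≡ true → u ∈ verts
    nonempty    : Nonempty verts
    connected   : ∀ u v → u ∈ verts → v ∈ verts → Walk edges u v
    acyclic     : ∀ v rest → ¬ IsCycle edges v rest
open Subtree public

numEdges : ∀ {n} {X : Graph n} → Subtree X → ℕ
numEdges {n} T =
  length (filter (λ p → (toℕ (proj₁ p) ℕ.<? toℕ (proj₂ p)) ×-dec (edges T (proj₁ p) (proj₂ p) BoolP.≟ true))
                 (cartesianProduct (Data.List.allFin n) (Data.List.allFin n)))
  where import Data.List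

_⊆ₛ_ : ∀ {n} → Subset n → Subset n → Set
S ⊆ₛ V = ∀ v → v ∈ S → v ∈ V

IsSteinerDistance : ∀ {n} → Graph n → Subset n → ℕ → Set
IsSteinerDistance X S d =
  (Σ (Subtree X) λ T → S ⊆ₛ verts T × numEdges T ≡ d)
  × (∀ (T : Subtree X) → S ⊆ₛ verts T → d ≤ numEdges T)

{-# OPTIONS --safe #-}
-- A smallest subtree containing S is the same as a smallest edge set of a connected subgraph
-- containing S: a minimal such edge set has no cycle, as deleting a cycle edge keeps it
-- connected. Such edge sets can be pushed forward along any map sending adjacent vertices to
-- adjacent or equal ones without gaining edges. Sending each vertex of G to the representative
-- of its twin class is such a map G → H, since twins have the same neighbours, and so is the
-- inclusion H → G; when S consists of representatives both maps fix S, so the two minima bound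
-- each other. Representatives containing S exist because S meets each class at most once:
-- take the member of S if there is one, and the least member otherwise.
module Submission where

open import Defs

open import Data.Bool using (Bool; true; false; _∧_; not)
open import Data.Bool.Properties using (∧-conicalˡ; ∧-zeroʳ)
import Data.Bool.Properties as Bool
open import Data.Empty using (⊥-elim)
open import Data.Fin using (Fin; toℕ; _≟_; _<?_; combine; remQuot)
  renaming (zero to fzero; suc to fsuc; _<_ to _<ᶠ_)
import Data.Fin.Properties as Fin
open import Data.Fin.Subset using (Subset; _∈_; ⁅_⁆; ∣_∣; _⊆_; _⊂_; Nonempty)
import Data.Fin.Subset.Properties as Subset
open import Data.List using (List; []; _∷_; _++_; length; filter; allFin; cartesianProduct; lookup)
open import Data.List.Membership.Propositional using () renaming (_∈_ to _∈ˡ_)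
open import Data.List.Membership.Propositional.Properties
  using (∈-filter⁺; ∈-filter⁻; ∈-cartesianProduct⁺; ∈-allFin; ∈-lookup)
open import Data.List.Relation.Unary.All as All using (All; []; _∷_)
open import Data.List.Relation.Unary.AllPairs using ([]; _∷_)
open import Data.List.Relation.Unary.Any using (here; there; index)
open import Data.List.Relation.Unary.Any.Properties using (lookup-index)
open import Data.List.Relation.Unary.Linked using (Linked; [-]; _∷_)
open import Data.List.Relation.Unary.Unique.Propositional using (Unique)
import Data.List.Relation.Unary.Unique.Propositional.Properties as Unique
open import Data.Nat as ℕ using (ℕ; zero; suc; _≤_; _<_; s≤s)
import Data.Nat.Properties as ℕ
open import Data.Product using (Σ; ∃; ∃₂; _×_; _,_; proj₁; proj₂; uncurry)
open import Data.Sum using (_⊎_; inj₁; inj₂)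
open import Data.Vec using (tabulate)
import Data.Vec.Properties as Vec
open import Function.Bundles using (_⇔_; mk⇔; Equivalence)
open import Relation.Nullary using (¬_; Dec; yes; no; does)
open import Relation.Nullary.Decidable
  using (_×-dec_; _⊎-dec_; _→-dec_; ¬?; map′; dec-true; dec-false; does-⇔)
open import Relation.Binary.Definitions using (tri<; tri≈; tri>)
open import Relation.Binary.PropositionalEquality
  using (_≡_; _≢_; refl; sym; trans; cong; cong₂; subst)

does⇒ : ∀ {A : Set} (a? : Dec A) → does a? ≡ true → A
does⇒ (yes a) _ = a

infix 2 _⇔-dec_
_⇔-dec_ : ∀ {A B : Set} → Dec A → Dec B → Dec (A ⇔ B)
a? ⇔-dec b? = map′ (uncurry mk⇔) (λ e → Equivalence.to e , Equivalence.from e)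
  ((a? →-dec b?) ×-dec (b? →-dec a?))

∈-tabulate⁺ : ∀ {n} (f : Fin n → Bool) {x} → f x ≡ true → x ∈ tabulate f
∈-tabulate⁺ f {x} fx = Vec.lookup⇒[]= x _ (trans (Vec.lookup∘tabulate f x) fx)

∈-tabulate⁻ : ∀ {n} (f : Fin n → Bool) {x} → x ∈ tabulate f → f x ≡ true
∈-tabulate⁻ f {x} x∈ = trans (sym (Vec.lookup∘tabulate f x)) (Vec.[]=⇒lookup x∈)

lookup-injective : ∀ {A : Set} {xs : List A} → Unique xs → ∀ i j → lookup xs i ≡ lookup xs j → i ≡ j
lookup-injective {xs = _ ∷ _} _            fzero    fzero    _  = refl
lookup-injective {xs = _ ∷ _} (x∉ ∷ _)     fzero    (fsuc j) eq = ⊥-elim (All.lookup x∉ (∈-lookup j) eq)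
lookup-injective {xs = _ ∷ _} (x∉ ∷ _)     (fsuc i) fzero    eq = ⊥-elim (All.lookup x∉ (∈-lookup i) (sym eq))
lookup-injective {xs = _ ∷ _} (_ ∷ unique) (fsuc i) (fsuc j) eq = cong fsuc (lookup-injective unique i j eq)

Unique⇒length-≤ : ∀ {A B : Set} {xs : List A} {ys : List B} → Unique xs →
  (f : ∀ {x} → x ∈ˡ xs → B) → (∀ {x} (x∈ : x ∈ˡ xs) → f x∈ ∈ˡ ys) →
  (∀ {x y} (x∈ : x ∈ˡ xs) (y∈ : y ∈ˡ xs) → f x∈ ≡ f y∈ → x ≡ y) → length xs ≤ length ys
Unique⇒length-≤ {xs = xs} {ys} unique f f∈ f-injective = Fin.injective⇒≤ position-injective
  where
  position : Fin (length xs) → Fin (length ys)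
  position i = index (f∈ (∈-lookup i))

  position-injective : ∀ {i j} → position i ≡ position j → i ≡ j
  position-injective {i} {j} eq = lookup-injective unique i j (f-injective (∈-lookup i) (∈-lookup j)
    (trans (lookup-index (f∈ (∈-lookup i)))
           (trans (cong (lookup ys) eq) (sym (lookup-index (f∈ (∈-lookup j)))))))

EdgeSet : ℕ → Set
EdgeSet n = Fin n → Fin n → Bool

module _ {n : ℕ} where

  _⊆ₑ_ : EdgeSet n → EdgeSet n → Set
  E ⊆ₑ F = ∀ u v → E u v ≡ true → F u v ≡ true

  _≈ₑ_ : EdgeSet n → EdgeSet n → Set
  E ≈ₑ F = ∀ u v → E u v ≡ F u v

  Symmetricₑ : EdgeSet n → Set
  Symmetricₑ E = ∀ u v → E u v ≡ E v u

  module _ {E : EdgeSet n} where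

    _++ʷ_ : ∀ {u v w} → Walk E u v → Walk E v w → Walk E u w
    []       ++ʷ q = q
    (e ∷ p) ++ʷ q = e ∷ (p ++ʷ q)

    reverseʷ : Symmetricₑ E → ∀ {u v} → Walk E u v → Walk E v u
    reverseʷ sym-E []       = []
    reverseʷ sym-E (e ∷ p) = reverseʷ sym-E p ++ʷ (trans (sym-E _ _) e ∷ [])

Walk-map : ∀ {m n} {E : EdgeSet m} {F : EdgeSet n} (f : Fin m → Fin n) →
  (∀ u v → E u v ≡ true → Walk F (f u) (f v)) → ∀ {u v} → Walk E u v → Walk F (f u) (f v)
Walk-map f step []      = []
Walk-map f step (e ∷ p) = step _ _ e ++ʷ Walk-map f step p

Walk-mono : ∀ {n} {E F : EdgeSet n} → E ⊆ₑ F → ∀ {u v} → Walk E u v → Walk F u v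
Walk-mono E⊆F = Walk-map (λ u → u) (λ u v e → E⊆F u v e ∷ [])

Walk-collapse : ∀ {m n} {E : EdgeSet m} {F : EdgeSet n} (f : Fin m → Fin n) →
  (∀ u v → E u v ≡ true → f u ≢ f v → F (f u) (f v) ≡ true) →
  ∀ {u v} → Walk E u v → Walk F (f u) (f v)
Walk-collapse {E = E} {F} f step = Walk-map f collapse
  where
  collapse : ∀ u v → E u v ≡ true → Walk F (f u) (f v)
  collapse u v e with f u ≟ f v
  ... | yes fu≡fv = subst (Walk F (f u)) fu≡fv []
  ... | no  fu≢fv = step u v e fu≢fv ∷ []

module Reachability {n : ℕ} (E : EdgeSet n) where

  ExtendsBy : Subset n → Fin n → Set
  ExtendsBy R v = v ∈ R ⊎ ∃ λ w → w ∈ R × E w v ≡ true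

  extendsBy? : ∀ R v → Dec (ExtendsBy R v)
  extendsBy? R v = v Subset.∈? R ⊎-dec Fin.any? (λ w → w Subset.∈? R ×-dec E w v Bool.≟ true)

  extend : Subset n → Subset n
  extend R = tabulate (λ v → does (extendsBy? R v))

  ∈-extend⁺ : ∀ {R v} → ExtendsBy R v → v ∈ extend R
  ∈-extend⁺ {R} {v} ext = ∈-tabulate⁺ _ (dec-true (extendsBy? R v) ext)

  ∈-extend⁻ : ∀ {R v} → v ∈ extend R → ExtendsBy R v
  ∈-extend⁻ {R} {v} v∈ = does⇒ (extendsBy? R v) (∈-tabulate⁻ _ v∈)

  ⊆-extend : ∀ R → R ⊆ extend R
  ⊆-extend R v∈R = ∈-extend⁺ (inj₁ v∈R)

  reachableWithin : ℕ → Fin n → Subset n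
  reachableWithin zero    u = ⁅ u ⁆
  reachableWithin (suc k) u = extend (reachableWithin k u)

  reachableWithin-sound : ∀ k {u v} → v ∈ reachableWithin k u → Walk E u v
  reachableWithin-sound zero    v∈ with Subset.x∈⁅y⁆⇒x≡y _ v∈
  ... | refl = []
  reachableWithin-sound (suc k) v∈ with ∈-extend⁻ v∈
  ... | inj₁ v∈′          = reachableWithin-sound k v∈′
  ... | inj₂ (w , w∈ , e) = reachableWithin-sound k w∈ ++ʷ (e ∷ [])

  ∈-reachableWithin : ∀ k u → u ∈ reachableWithin k u
  ∈-reachableWithin zero    u = Subset.x∈⁅x⁆ u
  ∈-reachableWithin (suc k) u = ⊆-extend _ (∈-reachableWithin k u)

  ⊂-extend : ∀ R → extend R ≢ R → R ⊂ extend R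
  ⊂-extend R R≢ with Fin.any? (λ v → v Subset.∈? extend R ×-dec ¬? (v Subset.∈? R))
  ... | yes (v , v∈ , v∉) = ⊆-extend R , v , v∈ , v∉
  ... | no  none           = ⊥-elim (R≢ (Subset.⊆-antisym (λ {v} → new⇒old v) (⊆-extend R)))
    where
    new⇒old : ∀ v → v ∈ extend R → v ∈ R
    new⇒old v v∈ with v Subset.∈? R
    ... | yes v∈R = v∈R
    ... | no  v∉R = ⊥-elim (none (v , v∈ , v∉R))

  stabilisesOrGrows : ∀ k u → (∃ λ j → extend (reachableWithin j u) ≡ reachableWithin j u)
                            ⊎ suc k ≤ ∣ reachableWithin k u ∣
  stabilisesOrGrows zero    u = inj₂ (ℕ.≤-reflexive (sym (Subset.∣⁅x⁆∣≡1 u)))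
  stabilisesOrGrows (suc k) u with stabilisesOrGrows k u
  ... | inj₁ stable = inj₁ stable
  ... | inj₂ grows with Vec.≡-dec Bool._≟_ (extend (reachableWithin k u)) (reachableWithin k u)
  ...   | yes stable = inj₁ (k , stable)
  ...   | no  moves  = inj₂ (ℕ.≤-trans (s≤s grows) (Subset.p⊂q⇒∣p∣<∣q∣ (⊂-extend _ moves)))

  stabilises : ∀ u → ∃ λ j → extend (reachableWithin j u) ≡ reachableWithin j u
  stabilises u with stabilisesOrGrows n u
  ... | inj₁ stable = stable
  ... | inj₂ grows  = ⊥-elim (ℕ.<-irrefl refl (ℕ.≤-trans grows (Subset.∣p∣≤n (reachableWithin n u))))

  reachable : Fin n → Subset n
  reachable u = reachableWithin (proj₁ (stabilises u)) u

  reachable-closed : ∀ {u v w} → v ∈ reachable u → Walk E v w → w ∈ reachable u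
  reachable-closed v∈ []            = v∈
  reachable-closed {u} v∈ (e ∷ p) =
    reachable-closed (subst (_ ∈_) (proj₂ (stabilises u)) (∈-extend⁺ (inj₂ (_ , v∈ , e)))) p

  walk? : ∀ u v → Dec (Walk E u v)
  walk? u v with v Subset.∈? reachable u
  ... | yes v∈ = yes (reachableWithin-sound (proj₁ (stabilises u)) v∈)
  ... | no  v∉ = no (λ p → v∉ (reachable-closed (∈-reachableWithin (proj₁ (stabilises u)) u) p))

Pair : ℕ → Set
Pair n = Fin n × Fin n

pairs : ∀ n → List (Pair n)
pairs n = cartesianProduct (allFin n) (allFin n)

∈-pairs : ∀ {n} (p : Pair n) → p ∈ˡ pairs n
∈-pairs (a , b) = ∈-cartesianProduct⁺ (∈-allFin a) (∈-allFin b)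

-- Chosen so that countEdges (edges T) unfolds to numEdges T: an undirected edge is counted
-- once, as the pair (a , b) with a < b.
IsEdge : ∀ {n} → EdgeSet n → Pair n → Set
IsEdge E (a , b) = toℕ a < toℕ b × E a b ≡ true

isEdge? : ∀ {n} (E : EdgeSet n) → ∀ p → Dec (IsEdge E p)
isEdge? E p = (toℕ (proj₁ p) ℕ.<? toℕ (proj₂ p)) ×-dec (E (proj₁ p) (proj₂ p) Bool.≟ true)

edgeList : ∀ {n} → EdgeSet n → List (Pair n)
edgeList {n} E = filter (isEdge? E) (pairs n)

countEdges : ∀ {n} → EdgeSet n → ℕ
countEdges E = length (edgeList E)

SameEdge : ∀ {n} → Fin n → Fin n → Fin n → Fin n → Set
SameEdge a b x y = (x ≡ a × y ≡ b) ⊎ (x ≡ b × y ≡ a)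

sameEdge? : ∀ {n} (a b x y : Fin n) → Dec (SameEdge a b x y)
sameEdge? a b x y = (x ≟ a ×-dec y ≟ b) ⊎-dec (x ≟ b ×-dec y ≟ a)

SameEdge-sym : ∀ {n} {a b x y : Fin n} → SameEdge a b x y → SameEdge a b y x
SameEdge-sym (inj₁ (x≡a , y≡b)) = inj₂ (y≡b , x≡a)
SameEdge-sym (inj₂ (x≡b , y≡a)) = inj₁ (y≡a , x≡b)

SameEdge-map : ∀ {m n} (f : Fin m → Fin n) {a b x y} → SameEdge a b x y → SameEdge (f a) (f b) (f x) (f y)
SameEdge-map f (inj₁ (x≡a , y≡b)) = inj₁ (cong f x≡a , cong f y≡b)
SameEdge-map f (inj₂ (x≡b , y≡a)) = inj₂ (cong f x≡b , cong f y≡a)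

ordered-SameEdge⇒≡ : ∀ {n} {a b x y : Fin n} → toℕ a < toℕ b → toℕ x < toℕ y →
  SameEdge a b x y → (x , y) ≡ (a , b)
ordered-SameEdge⇒≡ a<b x<y (inj₁ (refl , refl)) = refl
ordered-SameEdge⇒≡ a<b x<y (inj₂ (refl , refl)) = ⊥-elim (ℕ.<-asym a<b x<y)

sortPair : ∀ {n} → Fin n → Fin n → Pair n
sortPair a b with a <? b
... | yes _ = a , b
... | no  _ = b , a

sortPair-IsEdge : ∀ {n} {E : EdgeSet n} → Symmetricₑ E → ∀ {a b} → a ≢ b → E a b ≡ true →
  IsEdge E (sortPair a b)
sortPair-IsEdge sym-E {a} {b} a≢b e with a <? b
... | yes a<b = a<b , e
... | no  a≮b = ℕ.≤∧≢⇒< (ℕ.≮⇒≥ a≮b) (λ b≡a → a≢b (Fin.toℕ-injective (sym b≡a))) , trans (sym-E b a) e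

sortPair-SameEdge : ∀ {n} (a b : Fin n) → SameEdge a b (proj₁ (sortPair a b)) (proj₂ (sortPair a b))
sortPair-SameEdge a b with a <? b
... | yes _ = inj₁ (refl , refl)
... | no  _ = inj₂ (refl , refl)

sortPair-injective : ∀ {n} {a b x y : Fin n} → sortPair a b ≡ sortPair x y → SameEdge a b x y
sortPair-injective {a = a} {b} {x} {y} eq with a <? b | x <? y
... | yes _ | yes _ = inj₁ (sym (cong proj₁ eq) , sym (cong proj₂ eq))
... | yes _ | no  _ = inj₂ (sym (cong proj₂ eq) , sym (cong proj₁ eq))
... | no  _ | yes _ = inj₂ (sym (cong proj₁ eq) , sym (cong proj₂ eq))
... | no  _ | no  _ = inj₁ (sym (cong proj₂ eq) , sym (cong proj₁ eq))

module _ {n : ℕ} where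

  pairs-unique : Unique (pairs n)
  pairs-unique = Unique.cartesianProduct⁺ (Unique.allFin⁺ n) (Unique.allFin⁺ n)

  edgeList-unique : (E : EdgeSet n) → Unique (edgeList E)
  edgeList-unique E = Unique.filter⁺ (isEdge? E) pairs-unique

  ∈-edgeList⁺ : ∀ {E : EdgeSet n} {p} → IsEdge E p → p ∈ˡ edgeList E
  ∈-edgeList⁺ {E} e = ∈-filter⁺ (isEdge? E) (∈-pairs _) e

  ∈-edgeList⁻ : ∀ {E : EdgeSet n} {p} → p ∈ˡ edgeList E → IsEdge E p
  ∈-edgeList⁻ {E} p∈ = proj₂ (∈-filter⁻ (isEdge? E) {xs = pairs n} p∈)

countEdges-≤ : ∀ {m n} {E : EdgeSet m} {F : EdgeSet n} (f : ∀ p → IsEdge E p → Pair n) →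
  (∀ p e → IsEdge F (f p e)) → (∀ p q e e′ → f p e ≡ f q e′ → p ≡ q) → countEdges E ≤ countEdges F
countEdges-≤ {E = E} {F} f f-edge f-injective = Unique⇒length-≤ {ys = edgeList F} (edgeList-unique E)
  (λ p∈ → f _ (∈-edgeList⁻ p∈)) (λ p∈ → ∈-edgeList⁺ {E = F} (f-edge _ _))
  (λ p∈ q∈ → f-injective _ _ _ _)

countEdges-mono : ∀ {n} {E F : EdgeSet n} → E ⊆ₑ F → countEdges E ≤ countEdges F
countEdges-mono {E = E} {F} E⊆F =
  countEdges-≤ {E = E} {F} (λ p _ → p) (λ { (a , b) (a<b , e) → a<b , E⊆F a b e }) (λ _ _ _ _ eq → eq)

countEdges-cong : ∀ {n} {E F : EdgeSet n} → E ≈ₑ F → countEdges E ≡ countEdges F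
countEdges-cong E≈F = ℕ.≤-antisym (countEdges-mono (λ u v e → trans (sym (E≈F u v)) e))
                                  (countEdges-mono (λ u v e → trans (E≈F u v) e))

countEdges-< : ∀ {n} {E F : EdgeSet n} → E ⊆ₑ F → ∀ {p} → IsEdge F p → ¬ IsEdge E p →
  countEdges E < countEdges F
countEdges-< {E = E} {F} E⊆F {p} p∈F p∉E =
  Unique⇒length-≤ {ys = edgeList F} (p∉edgeList ∷ edgeList-unique E) (λ {q} _ → q) edge (λ _ _ eq → eq)
  where
  p∉edgeList : All (p ≢_) (edgeList E)
  p∉edgeList = All.tabulate (λ q∈ p≡q → p∉E (subst (IsEdge E) (sym p≡q) (∈-edgeList⁻ q∈)))

  edge : ∀ {q} → q ∈ˡ p ∷ edgeList E → q ∈ˡ edgeList F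
  edge (here refl) = ∈-edgeList⁺ p∈F
  edge {a , b} (there q∈) with ∈-edgeList⁻ q∈
  ... | a<b , e = ∈-edgeList⁺ (a<b , E⊆F a b e)

module _ {m n : ℕ} (f : Fin m → Fin n) (E : EdgeSet m) where

  ImageEdge : Fin n → Fin n → Set
  ImageEdge a b = a ≢ b × ∃₂ λ x y → f x ≡ a × f y ≡ b × E x y ≡ true

  imageEdge? : ∀ a b → Dec (ImageEdge a b)
  imageEdge? a b = ¬? (a ≟ b) ×-dec
    Fin.any? (λ x → Fin.any? (λ y → f x ≟ a ×-dec f y ≟ b ×-dec E x y Bool.≟ true))

  image : EdgeSet n
  image a b = does (imageEdge? a b)

  image⁺ : ∀ {x y} → f x ≢ f y → E x y ≡ true → image (f x) (f y) ≡ true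
  image⁺ {x} {y} fx≢fy e = dec-true (imageEdge? (f x) (f y)) (fx≢fy , x , y , refl , refl , e)

  image⁻ : ∀ {a b} → image a b ≡ true → ImageEdge a b
  image⁻ {a} {b} = does⇒ (imageEdge? a b)

  module _ (sym-E : Symmetricₑ E) where

    image-symmetric : Symmetricₑ image
    image-symmetric a b = does-⇔ (mk⇔ flip flip) (imageEdge? a b) (imageEdge? b a)
      where
      flip : ∀ {a b} → ImageEdge a b → ImageEdge b a
      flip (a≢b , x , y , fx≡a , fy≡b , e) =
        (λ b≡a → a≢b (sym b≡a)) , y , x , fy≡b , fx≡a , trans (sym-E y x) e

    -- Each edge of the image is charged to one of its preimage edges.
    countEdges-image : countEdges image ≤ countEdges E
    countEdges-image = countEdges-≤
      (λ _ e → preimage (image⁻ (proj₂ e))) (λ _ e → preimage-IsEdge (image⁻ (proj₂ e)))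
      λ { (a , b) (a′ , b′) (a<b , e) (a′<b′ , e′) eq →
            sym (ordered-SameEdge⇒≡ a<b a′<b′ (preimage-injective (image⁻ e) (image⁻ e′) eq)) }
      where
      preimage : ∀ {a b} → ImageEdge a b → Pair m
      preimage (_ , x , y , _) = sortPair x y

      preimage-IsEdge : ∀ {a b} (w : ImageEdge a b) → IsEdge E (preimage w)
      preimage-IsEdge (a≢b , x , y , refl , refl , e) = sortPair-IsEdge sym-E (λ x≡y → a≢b (cong f x≡y)) e

      preimage-injective : ∀ {a b a′ b′} (w : ImageEdge a b) (w′ : ImageEdge a′ b′) →
        preimage w ≡ preimage w′ → SameEdge a b a′ b′
      preimage-injective (_ , _ , _ , refl , refl , _) (_ , _ , _ , refl , refl , _) eq =
        SameEdge-map f (sortPair-injective eq)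

  Walk-image : ∀ {x y} → Walk E x y → Walk image (f x) (f y)
  Walk-image = Walk-collapse f (λ _ _ e fx≢fy → image⁺ fx≢fy e)

module _ {n : ℕ} where

  Support : Subset n → EdgeSet n → Fin n → Set
  Support S E u = u ∈ S ⊎ ∃ λ w → E u w ≡ true

  support? : ∀ S E u → Dec (Support S E u)
  support? S E u = u Subset.∈? S ⊎-dec Fin.any? (λ w → E u w Bool.≟ true)

  -- E is the edge set of a connected subgraph of X with vertex set Support S E.
  record SteinerSubgraph (X : Graph n) (S : Subset n) (E : EdgeSet n) : Set where
    field
      symmetric : Symmetricₑ E
      ⊆-adj     : E ⊆ₑ adj X
      connected : ∀ u v → Support S E u → Support S E v → Walk E u v

  open SteinerSubgraph public

  steinerSubgraph? : ∀ X S E → Dec (SteinerSubgraph X S E)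
  steinerSubgraph? X S E = map′ (λ (s , a , c) → record { symmetric = s ; ⊆-adj = a ; connected = c })
    (λ H → symmetric H , ⊆-adj H , connected H)
    (  Fin.all? (λ u → Fin.all? (λ v → E u v Bool.≟ E v u))
    ×-dec Fin.all? (λ u → Fin.all? (λ v → E u v Bool.≟ true →-dec adj X u v Bool.≟ true))
    ×-dec Fin.all? (λ u → Fin.all? (λ v →
            support? S E u →-dec (support? S E v →-dec Reachability.walk? E u v))))

  SteinerSubgraph-cong : ∀ {X S E F} → E ≈ₑ F → SteinerSubgraph X S E → SteinerSubgraph X S F
  SteinerSubgraph-cong {S = S} {E} {F} E≈F H = record
    { symmetric = λ u v → trans (sym (E≈F u v)) (trans (symmetric H u v) (E≈F v u))
    ; ⊆-adj     = λ u v e → ⊆-adj H u v (trans (E≈F u v) e)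
    ; connected = λ u v u∈ v∈ → Walk-mono E⊆F (connected H u v (support u∈) (support v∈))
    }
    where
    E⊆F : E ⊆ₑ F
    E⊆F u v e = trans (sym (E≈F u v)) e

    support : ∀ {u} → Support S F u → Support S E u
    support (inj₁ u∈S)     = inj₁ u∈S
    support (inj₂ (w , e)) = inj₂ (w , trans (E≈F _ w) e)

  Subtree⇒SteinerSubgraph : ∀ {X S} (T : Subtree X) → S ⊆ₛ verts T → SteinerSubgraph X S (edges T)
  Subtree⇒SteinerSubgraph {S = S} T S⊆T = record
    { symmetric = edges-sym T
    ; ⊆-adj     = edges-⊆ T
    ; connected = λ u v u∈ v∈ → Subtree.connected T u v (vertex u∈) (vertex v∈)
    }
    where
    vertex : ∀ {u} → Support S (edges T) u → u ∈ verts T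
    vertex (inj₁ u∈S)     = S⊆T _ u∈S
    vertex (inj₂ (w , e)) = edges-verts T _ w e

WeakHomomorphism : ∀ {m n} → Graph m → Graph n → (Fin m → Fin n) → Set
WeakHomomorphism X Y f = ∀ u v → adj X u v ≡ true → f u ≢ f v → adj Y (f u) (f v) ≡ true

module _ {m n} {X : Graph m} {Y : Graph n} {f : Fin m → Fin n} (hom : WeakHomomorphism X Y f) where

  Connected-image : (∀ a → ∃ λ x → f x ≡ a) → Connected X → Connected Y
  Connected-image surjective connected-X a b with surjective a | surjective b
  ... | x , refl | y , refl = Walk-collapse f hom (connected-X x y)

  SteinerSubgraph-image : ∀ {S T E} → (∀ a → a ∈ T → ∃ λ x → x ∈ S × f x ≡ a) →
    SteinerSubgraph X S E → SteinerSubgraph Y T (image f E)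
  SteinerSubgraph-image {S} {T} {E} T⊆fS H = record
    { symmetric = image-symmetric f E (symmetric H)
    ; ⊆-adj     = adjacent
    ; connected = connect
    }
    where
    adjacent : image f E ⊆ₑ adj Y
    adjacent a b e with image⁻ f E e
    ... | a≢b , x , y , refl , refl , exy = hom x y (⊆-adj H x y exy) a≢b

    preimage : ∀ {a} → Support T (image f E) a → ∃ λ x → Support S E x × f x ≡ a
    preimage (inj₁ a∈T) with T⊆fS _ a∈T
    ... | x , x∈S , fx≡a = x , inj₁ x∈S , fx≡a
    preimage (inj₂ (b , e)) with image⁻ f E e
    ... | _ , x , y , fx≡a , _ , exy = x , inj₂ (y , exy) , fx≡a

    connect : ∀ a b → Support T (image f E) a → Support T (image f E) b → Walk (image f E) a b
    connect a b a∈ b∈ with preimage a∈ | preimage b∈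
    ... | x , x∈ , refl | y , y∈ , refl = Walk-image f E (connected H x y x∈ y∈)

module _ {n : ℕ} (a b : Fin n) where

  deleteEdge : EdgeSet n → EdgeSet n
  deleteEdge E x y = E x y ∧ not (does (sameEdge? a b x y))

  OffEdge : Fin n → Set
  OffEdge x = x ≢ a × x ≢ b

  ¬SameEdge-source : ∀ {x y} → OffEdge x → ¬ SameEdge a b x y
  ¬SameEdge-source (x≢a , _) (inj₁ (x≡a , _)) = x≢a x≡a
  ¬SameEdge-source (_ , x≢b) (inj₂ (x≡b , _)) = x≢b x≡b

  ¬SameEdge-target : ∀ {x y} → OffEdge y → ¬ SameEdge a b x y
  ¬SameEdge-target off same = ¬SameEdge-source off (SameEdge-sym same)

  module _ {E : EdgeSet n} where

    deleteEdge-⊆ : deleteEdge E ⊆ₑ E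
    deleteEdge-⊆ x y e = ∧-conicalˡ (E x y) _ e

    deleteEdge-keeps : ∀ {x y} → E x y ≡ true → ¬ SameEdge a b x y → deleteEdge E x y ≡ true
    deleteEdge-keeps {x} {y} e ¬same rewrite e | dec-false (sameEdge? a b x y) ¬same = refl

    deleteEdge-deletes : ∀ {x y} → SameEdge a b x y → deleteEdge E x y ≡ false
    deleteEdge-deletes {x} {y} same rewrite dec-true (sameEdge? a b x y) same = ∧-zeroʳ (E x y)

    deleteEdge-symmetric : Symmetricₑ E → Symmetricₑ (deleteEdge E)
    deleteEdge-symmetric sym-E x y =
      cong₂ _∧_ (sym-E x y)
        (cong not (does-⇔ (mk⇔ SameEdge-sym SameEdge-sym) (sameEdge? a b x y) (sameEdge? a b y x)))

    Linked⇒Walk-deleteEdge : ∀ {x} zs {y} → All OffEdge (x ∷ zs) →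
      Linked (λ u v → E u v ≡ true) (x ∷ zs ++ y ∷ []) → Walk (deleteEdge E) x y
    Linked⇒Walk-deleteEdge []       (off ∷ [])   (e ∷ [-])    = deleteEdge-keeps e (¬SameEdge-source off) ∷ []
    Linked⇒Walk-deleteEdge (z ∷ zs) (off ∷ offs) (e ∷ linked) =
      deleteEdge-keeps e (¬SameEdge-source off) ∷ Linked⇒Walk-deleteEdge zs offs linked

-- The rest of the cycle is a detour around the deleted edge.
SteinerSubgraph-deleteCycleEdge : ∀ {n} {X : Graph n} {S E} → SteinerSubgraph X S E → ∀ {v rest} →
  IsCycle E v rest → ∃ λ E′ → SteinerSubgraph X S E′ × countEdges E′ < countEdges E
SteinerSubgraph-deleteCycleEdge H {rest = []}     (() , _)
SteinerSubgraph-deleteCycleEdge H {rest = _ ∷ []} (s≤s () , _)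
SteinerSubgraph-deleteCycleEdge {S = S} {E} H {v} {r₁ ∷ r₂ ∷ rs}
                                (_ , (v∉ ∷ r₁∉ ∷ _) , (e₀ ∷ e₁ ∷ linked)) =
  E′ , steiner , countEdges-< (deleteEdge-⊆ v r₁ {E}) (sortPair-IsEdge (symmetric H) v≢r₁ e₀) deleted
  where
  E′ : EdgeSet _
  E′ = deleteEdge v r₁ E

  v≢r₁ : v ≢ r₁
  v≢r₁ = All.head v∉

  offs : All (OffEdge v r₁) (r₂ ∷ rs)
  offs = All.tabulate λ x∈ →
    (λ x≡v → All.lookup v∉ (there x∈) (sym x≡v)) , (λ x≡r₁ → All.lookup r₁∉ x∈ (sym x≡r₁))

  detour : Walk E′ r₁ v
  detour = deleteEdge-keeps v r₁ {E} e₁ (¬SameEdge-target v r₁ (All.head offs))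
         ∷ Linked⇒Walk-deleteEdge v r₁ {E} rs offs linked

  reroute : ∀ x y → E x y ≡ true → Walk E′ x y
  reroute x y e with sameEdge? v r₁ x y
  ... | no  ¬same                = deleteEdge-keeps v r₁ {E} e ¬same ∷ []
  ... | yes (inj₁ (refl , refl)) = reverseʷ (deleteEdge-symmetric v r₁ {E} (symmetric H)) detour
  ... | yes (inj₂ (refl , refl)) = detour

  support : ∀ {x} → Support S E′ x → Support S E x
  support (inj₁ x∈S)     = inj₁ x∈S
  support (inj₂ (w , e)) = inj₂ (w , deleteEdge-⊆ v r₁ {E} _ w e)

  steiner : SteinerSubgraph _ S E′
  steiner = record
    { symmetric = deleteEdge-symmetric v r₁ {E} (symmetric H)
    ; ⊆-adj     = λ x y e → ⊆-adj H x y (deleteEdge-⊆ v r₁ {E} x y e)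
    ; connected = λ x y x∈ y∈ → Walk-map (λ u → u) reroute (connected H x y (support x∈) (support y∈))
    }

  deleted : ¬ IsEdge E′ (sortPair v r₁)
  deleted (_ , e′) with trans (sym e′) (deleteEdge-deletes v r₁ {E} (sortPair-SameEdge v r₁))
  ... | ()

module _ {n : ℕ} where

  -- Edge sets are searched through their encodings as subsets of Fin (n * n).
  encode : EdgeSet n → Subset (n ℕ.* n)
  encode E = tabulate (λ i → uncurry E (remQuot n i))

  decode : Subset (n ℕ.* n) → EdgeSet n
  decode R x y = Data.Vec.lookup R (combine x y)

  decode-encode : ∀ E → decode (encode E) ≈ₑ E
  decode-encode E x y =
    trans (Vec.lookup∘tabulate _ (combine x y)) (cong (uncurry E) (Fin.remQuot-combine x y))

  anyEdgeSet? : ∀ {P : EdgeSet n → Set} → (∀ {E F} → E ≈ₑ F → P E → P F) → (∀ E → Dec (P E)) → Dec (∃ P)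
  anyEdgeSet? P-cong P? = map′ (λ (R , p) → decode R , p)
    (λ (E , p) → encode E , P-cong (λ x y → sym (decode-encode E x y)) p)
    (Subset.anySubset? (λ R → P? (decode R)))

module _ {n : ℕ} {X : Graph n} {S : Subset n} where

  IsMinimum : EdgeSet n → Set
  IsMinimum E = SteinerSubgraph X S E × ∀ F → SteinerSubgraph X S F → countEdges E ≤ countEdges F

  smaller? : (E : EdgeSet n) → Dec (∃ λ (F : EdgeSet n) → SteinerSubgraph X S F × countEdges F < countEdges E)
  smaller? E = anyEdgeSet? {P = λ (F : EdgeSet n) → SteinerSubgraph X S F × countEdges F < countEdges E}
    (λ F≈F′ (H , F<E) → SteinerSubgraph-cong F≈F′ H , subst (_< countEdges E) (countEdges-cong F≈F′) F<E)
    (λ F → steinerSubgraph? X S F ×-dec countEdges F ℕ.<? countEdges E)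

  minimumWithin : ∀ k {E : EdgeSet n} → countEdges E ≤ k → SteinerSubgraph X S E → ∃ IsMinimum
  minimumWithin k {E} E≤k H with smaller? E
  ... | no none = E , H , λ F H′ → ℕ.≮⇒≥ (λ F<E → none (F , H′ , F<E))
  minimumWithin zero    E≤0 H | yes (F , _ , F<E) with ℕ.≤-trans F<E E≤0
  ... | ()
  minimumWithin (suc k) E≤k H | yes (F , H′ , F<E) = minimumWithin k (ℕ.≤-pred (ℕ.≤-trans F<E E≤k)) H′

  minimumSteinerSubgraph : ∀ {E : EdgeSet n} → SteinerSubgraph X S E → ∃ IsMinimum
  minimumSteinerSubgraph {E} = minimumWithin (countEdges E) ℕ.≤-refl

  minimum⇒Subtree : Nonempty S → ∀ {E} → IsMinimum E →
    Σ (Subtree X) λ T → S ⊆ₛ verts T × numEdges T ≡ countEdges E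
  minimum⇒Subtree (s , s∈S) {E} (H , minimal) = T , (λ u u∈S → ∈-vertices (inj₁ u∈S)) , refl
    where
    vertices : Subset n
    vertices = tabulate (λ u → does (support? S E u))

    ∈-vertices : ∀ {u} → Support S E u → u ∈ vertices
    ∈-vertices {u} u∈ = ∈-tabulate⁺ _ (dec-true (support? S E u) u∈)

    ∈-vertices⁻ : ∀ {u} → u ∈ vertices → Support S E u
    ∈-vertices⁻ {u} u∈ = does⇒ (support? S E u) (∈-tabulate⁻ _ u∈)

    acyclic′ : ∀ v rest → ¬ IsCycle E v rest
    acyclic′ v rest cycle with SteinerSubgraph-deleteCycleEdge H cycle
    ... | F , H′ , F<E = ℕ.<-irrefl refl (ℕ.<-≤-trans F<E (minimal F H′))

    T : Subtree X
    T = record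
      { verts       = vertices
      ; edges       = E
      ; edges-sym   = symmetric H
      ; edges-⊆     = ⊆-adj H
      ; edges-verts = λ u v e → ∈-vertices (inj₂ (v , e))
      ; nonempty    = s , ∈-vertices (inj₁ s∈S)
      ; connected   = λ u v u∈ v∈ → connected H u v (∈-vertices⁻ u∈) (∈-vertices⁻ v∈)
      ; acyclic     = acyclic′
      }

  minimumSubtree : Nonempty S → ∀ {E} → SteinerSubgraph X S E →
    Σ (Subtree X) λ T → S ⊆ₛ verts T × ∀ {F} → SteinerSubgraph X S F → numEdges T ≤ countEdges F
  minimumSubtree nonempty H with minimumSteinerSubgraph H
  ... | E₀ , minimum@(_ , minimal) with minimum⇒Subtree nonempty minimum
  ...   | T , S⊆T , T≡E₀ = T , S⊆T , λ H′ → subst (_≤ _) (sym T≡E₀) (minimal _ H′)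

  IsSteinerDistance-≤ : Nonempty S → ∀ {d} → IsSteinerDistance X S d →
    ∀ {E} → SteinerSubgraph X S E → d ≤ countEdges E
  IsSteinerDistance-≤ nonempty (_ , d≤) H with minimumSubtree nonempty H
  ... | T , S⊆T , T≤ = ℕ.≤-trans (d≤ T S⊆T) (T≤ H)

  adj-SteinerSubgraph : Connected X → SteinerSubgraph X S (adj X)
  adj-SteinerSubgraph connected-X = record
    { symmetric = adj-sym X ; ⊆-adj = λ _ _ e → e ; connected = λ u v _ _ → connected-X u v }

  steinerDistance : Connected X → Nonempty S → ∃ (IsSteinerDistance X S)
  steinerDistance connected-X nonempty with minimumSubtree nonempty (adj-SteinerSubgraph connected-X)
  ... | T , S⊆T , T≤ = numEdges T , (T , S⊆T , refl) , λ T′ S⊆T′ → T≤ (Subtree⇒SteinerSubgraph T′ S⊆T′)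

IsSteinerDistance-image-≤ : ∀ {m n} {X : Graph m} {Y : Graph n} {f : Fin m → Fin n} →
  WeakHomomorphism X Y f →
  ∀ {S T} → (∀ a → a ∈ T → ∃ λ x → x ∈ S × f x ≡ a) → Nonempty T →
  ∀ {dX dY} → IsSteinerDistance X S dX → IsSteinerDistance Y T dY → dY ≤ dX
IsSteinerDistance-image-≤ {f = f} hom T⊆fS nonempty ((T₀ , S⊆T₀ , T₀≡dX) , _) steinerY = begin
  _                                   ≤⟨ IsSteinerDistance-≤ nonempty steinerY (SteinerSubgraph-image hom T⊆fS H₀) ⟩
  countEdges (image f (edges T₀))     ≤⟨ countEdges-image f (edges T₀) (edges-sym T₀) ⟩
  countEdges (edges T₀)               ≡⟨ T₀≡dX ⟩
  _                                   ∎
  where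
  open ℕ.≤-Reasoning
  H₀ = Subtree⇒SteinerSubgraph T₀ S⊆T₀

module _ {n : ℕ} (G : Graph n) where

  adj⇒≢ : ∀ {u v} → adj G u v ≡ true → u ≢ v
  adj⇒≢ {u} e refl with trans (sym e) (adj-irrefl G u)
  ... | ()

  adj-flip : ∀ {u v} → adj G u v ≡ true → adj G v u ≡ true
  adj-flip {u} {v} e = trans (adj-sym G v u) e

  Twin-refl : ∀ u → Twin G u u
  Twin-refl u w = mk⇔ (λ p → p) (λ p → p)

  Twin-sym : ∀ {u v} → Twin G u v → Twin G v u
  Twin-sym t w = mk⇔ (Equivalence.from (t w)) (Equivalence.to (t w))

  Twin⇒adj : ∀ {u v w} → Twin G u v → adj G u w ≡ true → w ≢ v → adj G v w ≡ true
  Twin⇒adj t e w≢v = proj₁ (Equivalence.to (t _) (e , w≢v))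

  Twin-trans : ∀ {u v w} → Twin G u v → Twin G v w → Twin G u w
  Twin-trans t₁ t₂ x = mk⇔ (forward t₁ t₂) (forward (Twin-sym t₂) (Twin-sym t₁))
    where
    forward : ∀ {u v w x} → Twin G u v → Twin G v w → N G u x × x ≢ w → N G w x × x ≢ u
    forward {u} {v} {w} {x} t₁ t₂ (ux , x≢w) = wx , (λ x≡u → adj⇒≢ ux (sym x≡u))
      where
      wx : N G w x
      wx with x ≟ v
      ... | no  x≢v = Twin⇒adj t₂ (Twin⇒adj t₁ ux x≢v) x≢w
      ... | yes refl with u ≟ w  -- x = v: from v ~ u get w ~ u, and from u ~ w get v ~ w
      ...   | yes refl = ux
      ...   | no  u≢w  =
        adj-flip (Twin⇒adj t₁ (adj-flip (Twin⇒adj t₂ (adj-flip ux) u≢w)) (λ w≡x → x≢w (sym w≡x)))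

  twin? : ∀ u v → Dec (Twin G u v)
  twin? u v = Fin.all? λ w →
    (adj G u w Bool.≟ true ×-dec ¬? (w ≟ v)) ⇔-dec (adj G v w Bool.≟ true ×-dec ¬? (w ≟ u))

Least : ∀ {n} → (Fin n → Set) → Fin n → Set
Least P i = P i × ∀ j → j <ᶠ i → ¬ P j

Least-unique : ∀ {n} {P Q : Fin n → Set} → (∀ {i} → P i ⇔ Q i) → ∀ {i j} → Least P i → Least Q j → i ≡ j
Least-unique P⇔Q {i} {j} (pi , below-i) (qj , below-j) with Fin.<-cmp i j
... | tri< i<j _ _ = ⊥-elim (below-j i i<j (Equivalence.to P⇔Q pi))
... | tri≈ _ i≡j _ = i≡j
... | tri> _ _ j<i = ⊥-elim (below-i j j<i (Equivalence.from P⇔Q qj))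

least : ∀ {n} {P : Fin n → Set} → (∀ i → Dec (P i)) → ∃ P → ∃ (Least P)
least {suc n} {P} P? (i , pi) with P? fzero
... | yes p₀ = fzero , p₀ , λ _ ()
... | no ¬p₀ with i | pi
...   | fzero   | p₀ = ⊥-elim (¬p₀ p₀)
...   | fsuc i′ | pi′ with least (λ j → P? (fsuc j)) (i′ , pi′)
...     | j , pj , below-j = fsuc j , pj , below
  where
  below : ∀ j′ → j′ <ᶠ fsuc j → ¬ P j′
  below fzero      _         = ¬p₀
  below (fsuc j′) (s≤s j′<j) = below-j j′ j′<j

module _ {n k : ℕ} (c : Fin k → Fin n) {S : Subset n} where

  ∈-pullback⁺ : ∀ {i} → c i ∈ S → i ∈ pullback c S
  ∈-pullback⁺ {i} ci∈S = Vec.lookup⇒[]= i _ (trans (Vec.lookup∘tabulate _ i) (Vec.[]=⇒lookup ci∈S))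

  ∈-pullback⁻ : ∀ {i} → i ∈ pullback c S → c i ∈ S
  ∈-pullback⁻ {i} i∈ = Vec.lookup⇒[]= (c i) S (trans (sym (Vec.lookup∘tabulate _ i)) (Vec.[]=⇒lookup i∈))

c-weakHomomorphism : ∀ {n k} {G : Graph n} (c : Fin k → Fin n) → WeakHomomorphism (induced G c) G c
c-weakHomomorphism c i j e _ = e

module _ {n k : ℕ} {G : Graph n} {c : Fin k → Fin n} (reps : Representatives G k c) where
  open Representatives reps

  classOf : Fin n → Fin k
  classOf v = proj₁ (cover v)

  Twin-classOf : ∀ v → Twin G v (c (classOf v))
  Twin-classOf v = proj₂ (cover v)

  classOf-c : ∀ i → classOf (c i) ≡ i
  classOf-c i = sym (distinct i _ (Twin-classOf (c i)))

  classOf-weakHomomorphism : WeakHomomorphism G (induced G c) classOf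
  classOf-weakHomomorphism x y e classes≢ = adj-flip G b~a
    where
    a = c (classOf x)
    b = c (classOf y)

    y≢a : y ≢ a
    y≢a y≡a = classes≢ (distinct _ _ (subst (λ z → Twin G z b) y≡a (Twin-classOf y)))

    a≢b : a ≢ b
    a≢b a≡b = classes≢ (distinct _ _ (subst (Twin G a) a≡b (Twin-refl G a)))

    a~y : adj G a y ≡ true
    a~y = Twin⇒adj G (Twin-classOf x) e y≢a

    b~a : adj G b a ≡ true
    b~a = Twin⇒adj G (Twin-classOf y) (adj-flip G a~y) a≢b

module _ {n : ℕ} (G : Graph n) (S : Subset n)
         (S-twinFree : ∀ u v → u ∈ S → v ∈ S → Twin G u v → u ≡ v) where

  -- The representative of a class is its least Eligible member, i.e. its member in S if it has one.
  Eligible : Fin n → Fin n → Set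
  Eligible v u = Twin G v u × (u ∈ S ⊎ ¬ (∃ λ s → s ∈ S × Twin G v s))

  eligible? : ∀ v u → Dec (Eligible v u)
  eligible? v u = twin? G v u ×-dec (u Subset.∈? S ⊎-dec ¬? (Fin.any? λ s → s Subset.∈? S ×-dec twin? G v s))

  eligible-exists : ∀ v → ∃ (Eligible v)
  eligible-exists v with Fin.any? (λ s → s Subset.∈? S ×-dec twin? G v s)
  ... | yes (s , s∈S , v~s) = s , v~s , inj₁ s∈S
  ... | no  none            = v , Twin-refl G v , inj₂ none

  Eligible-cong : ∀ {v v′} → Twin G v v′ → ∀ {u} → Eligible v u ⇔ Eligible v′ u
  Eligible-cong v~v′ = mk⇔ (transport v~v′) (transport (Twin-sym G v~v′))
    where
    transport : ∀ {v v′ u} → Twin G v v′ → Eligible v u → Eligible v′ u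
    transport v~v′ (v~u , inj₁ u∈S) = Twin-trans G (Twin-sym G v~v′) v~u , inj₁ u∈S
    transport v~v′ (v~u , inj₂ none) = Twin-trans G (Twin-sym G v~v′) v~u ,
      inj₂ (λ (s , s∈S , v′~s) → none (s , s∈S , Twin-trans G v~v′ v′~s))

  representative : Fin n → Fin n
  representative v = proj₁ (least (eligible? v) (eligible-exists v))

  representative-least : ∀ v → Least (Eligible v) (representative v)
  representative-least v = proj₂ (least (eligible? v) (eligible-exists v))

  Twin-representative : ∀ v → Twin G v (representative v)
  Twin-representative v = proj₁ (proj₁ (representative-least v))

  representative-cong : ∀ {v v′} → Twin G v v′ → representative v ≡ representative v′
  representative-cong {v} {v′} v~v′ =
    Least-unique (Eligible-cong v~v′) (representative-least v) (representative-least v′)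

  representative-idem : ∀ v → representative (representative v) ≡ representative v
  representative-idem v = representative-cong (Twin-sym G (Twin-representative v))

  representative-∈S : ∀ {s} → s ∈ S → representative s ≡ s
  representative-∈S {s} s∈S with proj₁ (representative-least s)
  ... | s~r , inj₁ r∈S = sym (S-twinFree s _ s∈S r∈S s~r)
  ... | _   , inj₂ none = ⊥-elim (none (s , s∈S , Twin-refl G s))

  representatives : List (Fin n)
  representatives = filter (λ v → representative v ≟ v) (allFin n)

  representativeAt : Fin (length representatives) → Fin n
  representativeAt = lookup representatives

  representativeAt-surjective : ∀ {v} → representative v ≡ v → ∃ λ i → representativeAt i ≡ v
  representativeAt-surjective {v} fixed = index v∈ , sym (lookup-index v∈)
    where
    v∈ = ∈-filter⁺ (λ v → representative v ≟ v) (∈-allFin v) fixed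

  representative-representativeAt : ∀ i → representative (representativeAt i) ≡ representativeAt i
  representative-representativeAt i =
    proj₂ (∈-filter⁻ (λ v → representative v ≟ v) {xs = allFin n} (∈-lookup i))

  Representatives-representativeAt : Representatives G (length representatives) representativeAt
  Representatives-representativeAt = record
    { distinct = λ i j twins → lookup-injective (Unique.filter⁺ _ (Unique.allFin⁺ n)) i j
        (trans (sym (representative-representativeAt i))
               (trans (representative-cong twins) (representative-representativeAt j)))
    ; cover    = λ v → let i , eq = representativeAt-surjective (representative-idem v) in
        i , subst (Twin G v) (sym eq) (Twin-representative v)
    }

  representativeAt-⊇S : ∀ s → s ∈ S → ∃ λ i → representativeAt i ≡ s
  representativeAt-⊇S s s∈S = representativeAt-surjective (representative-∈S s∈S)

1≤∣p∣⇒Nonempty : ∀ {n} {p : Subset n} → 1 ≤ ∣ p ∣ → Nonempty p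
1≤∣p∣⇒Nonempty {n} {p} 1≤∣p∣ with Subset.nonempty? p
... | yes nonempty = nonempty
... | no  empty
  with ℕ.≤-trans 1≤∣p∣ (ℕ.≤-reflexive (trans (cong ∣_∣ (Subset.Empty-unique empty)) (Subset.∣⊥∣≡0 n)))
...   | ()

module _ {n k : ℕ} {G : Graph n} {c : Fin k → Fin n} (reps : Representatives G k c)
         {S : Subset n} (S⊆c : ∀ s → s ∈ S → ∃ λ i → c i ≡ s) where

  private
    H  = induced G c
    Sᵣ = pullback c S

  Sᵣ⊆classOf[S] : ∀ i → i ∈ Sᵣ → ∃ λ x → x ∈ S × classOf reps x ≡ i
  Sᵣ⊆classOf[S] i i∈ = c i , ∈-pullback⁻ c i∈ , classOf-c reps i

  S⊆c[Sᵣ] : ∀ s → s ∈ S → ∃ λ i → i ∈ Sᵣ × c i ≡ s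
  S⊆c[Sᵣ] s s∈S with S⊆c s s∈S
  ... | i , refl = i , ∈-pullback⁺ c s∈S , refl

  Nonempty-Sᵣ : Nonempty S → Nonempty Sᵣ
  Nonempty-Sᵣ (s , s∈S) with S⊆c[Sᵣ] s s∈S
  ... | i , i∈ , _ = i , i∈

  Connected-induced : Connected G → Connected H
  Connected-induced =
    Connected-image {X = G} {Y = H} (classOf-weakHomomorphism reps) (λ i → c i , classOf-c reps i)

  steinerDistance-induced : Connected G → Nonempty S →
    ∃ λ d → IsSteinerDistance H Sᵣ d × IsSteinerDistance G S d
  steinerDistance-induced connected-G nonempty-S
    with steinerDistance connected-G nonempty-S
       | steinerDistance (Connected-induced connected-G) (Nonempty-Sᵣ nonempty-S)
  ... | dG , steinerG | dH , steinerH =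
    dG , subst (IsSteinerDistance H Sᵣ) (ℕ.≤-antisym dH≤dG dG≤dH) steinerH , steinerG
    where
    dH≤dG : dH ≤ dG
    dH≤dG = IsSteinerDistance-image-≤ (classOf-weakHomomorphism reps) Sᵣ⊆classOf[S] (Nonempty-Sᵣ nonempty-S)
              steinerG steinerH

    dG≤dH : dG ≤ dH
    dG≤dH = IsSteinerDistance-image-≤ (c-weakHomomorphism {G = G} c) S⊆c[Sᵣ] nonempty-S steinerH steinerG

lemma2p7 : ∀ {n} (G : Graph n) → Connected G → (S : Subset n) → 1 ≤ ∣ S ∣
  → (∀ u v → u ∈ S → v ∈ S → Twin G u v → u ≡ v)
  → (∃ λ k → Σ (Fin k → Fin n) λ c → Representatives G k c × (∀ s → s ∈ S → ∃ λ i → c i ≡ s))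
    × (∀ k (c : Fin k → Fin n) → Representatives G k c → (∀ s → s ∈ S → ∃ λ i → c i ≡ s)
        → ∃ λ d → IsSteinerDistance (induced G c) (pullback c S) d × IsSteinerDistance G S d)
lemma2p7 G connected-G S 1≤∣S∣ S-twinFree =
  ( length (representatives G S S-twinFree) , representativeAt G S S-twinFree
  , Representatives-representativeAt G S S-twinFree , representativeAt-⊇S G S S-twinFree )
  , λ k c reps S⊆c → steinerDistance-induced reps S⊆c connected-G (1≤∣p∣⇒Nonempty 1≤∣S∣)
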